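{- There exist two directed acyclic graphs $G_1$ and $G_2$, each with a unique sink, having the same underlying undirected graph, such that $\mathrm{rev}(G_1)\neq\mathrm{rev}(G_2)$. (For instance, on vertex set $\{1,\dots,7\}$, $G_1$ has edges $2\to1,3\to1,4\to1,4\to3,5\to4,6\to4,7\to4$ with $\mathrm{rev}(G_1)=5$, and $G_2$ has edges $2\to1,3\to1,4\to1,3\to4,5\to4,6\to4,7\to4$ with $\mathrm{rev}(G_2)=6$.)
   Context: A persistent reversible pebbling of a directed acyclic graph $G$ with unique sink $r$ is a sequence $P_1,\dots,P_m$ of vertex subsets with $P_1=\emptyset$, $P_m=\{r\}$, such that each $P_i$ ($i\ge2$) is obtained from $P_{i-1}$ by adding or removing exactly one vertex $v$, all of whose in-neighbours lie in $P_{i-1}$. Its number of pebbles is $\max_i|P_i|$, and $\mathrm{rev}(G)$ is the minimum number of pebbles over all such pebblings. -}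

module Defs where

open import Data.Nat using (ℕ; zero; suc; _≤_; _⊔_)
open import Data.Fin using (Fin; zero; suc; fromℕ; inject₁)
open import Data.Fin.Subset using (Subset; _∈_; ⊥; ⁅_⁆; ∣_∣)
open import Data.Vec using (_[_]≔_; lookup)
open import Data.Bool using (not)
open import Data.List using (List; []; _∷_; map; foldr; allFin)
open import Data.Product using (Σ; ∃; ∃-syntax; _×_; _,_)
open import Relation.Binary.PropositionalEquality using (_≡_)
open import Relation.Nullary using (¬_)
open import Data.Sum using (_⊎_)
open import Function.Bundles using (_⇔_)

Digraph : ℕ → Set₁
Digraph n = Fin n → Fin n → Set

data Walk⁺ {n : ℕ} (E : Digraph n) : Fin n → Fin n → Set where
  edge : ∀ {u v} → E u v → Walk⁺ E u v
  _∷ʷ_ : ∀ {u v w} → E u v → Walk⁺ E v w → Walk⁺ E u w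

Acyclic : ∀ {n} → Digraph n → Set
Acyclic {n} E = ∀ (v : Fin n) → ¬ Walk⁺ E v v

IsSink : ∀ {n} → Digraph n → Fin n → Set
IsSink {n} E v = ∀ (w : Fin n) → ¬ E v w

UniqueSink : ∀ {n} → Digraph n → Fin n → Set
UniqueSink {n} E r = IsSink E r × (∀ (v : Fin n) → IsSink E v → v ≡ r)

record DAG (n : ℕ) : Set₁ where
  field
    E       : Digraph n
    acyclic : Acyclic E
    sink    : Fin n
    unique  : UniqueSink E sink
open DAG public

SameUnderlying : ∀ {n} → Digraph n → Digraph n → Set
SameUnderlying {n} E₁ E₂ = ∀ (u v : Fin n) → (E₁ u v ⊎ E₁ v u) ⇔ (E₂ u v ⊎ E₂ v u)

Move : ∀ {n} → Digraph n → Subset n → Subset n → Set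
Move {n} E P Q = ∃[ v ] ((∀ (u : Fin n) → E u v → u ∈ P) × (Q ≡ P [ v ]≔ not (lookup P v)))

-- A persistent reversible pebbling P_1,…,P_{m+1} (indexed by Fin (suc m)).
record Pebbling {n : ℕ} (E : Digraph n) (r : Fin n) : Set where
  field
    m       : ℕ
    config  : Fin (suc m) → Subset n
    start   : config zero ≡ ⊥
    finish  : config (fromℕ m) ≡ ⁅ r ⁆
    steps   : ∀ (i : Fin m) → Move E (config (inject₁ i)) (config (suc i))
open Pebbling public

pebbles : ∀ {n} {E : Digraph n} {r : Fin n} → Pebbling E r → ℕ
pebbles p = foldr _⊔_ 0 (map (λ i → ∣ config p i ∣) (allFin (suc (m p))))

IsRev : ∀ {n} → DAG n → ℕ → Set
IsRev G k = (Σ (Pebbling (E G) (sink G)) λ p → pebbles p ≡ k)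
          × (∀ (p : Pebbling (E G) (sink G)) → k ≤ pebbles p)

-- A pebble can only be placed on the sink while all of its in-neighbours carry
-- pebbles, so every pebbling uses at least indeg(sink) + 1 pebbles.  The triangle
-- 0–1–2 with a pendant edge 0–3 can be oriented with sink 0 of in-degree 3, or
-- with sink 1 of in-degree 2; explicit pebblings attain both bounds, so the two
-- orientations have reversible pebbling numbers 4 and 3.
module Submission where

open import Defs
open import Data.Nat using (ℕ; zero; suc; _≤_; _<_; _⊔_; z≤n; s≤s)
open import Data.Nat.Properties using (≤-trans; <-trans; <-irrefl; m≤m⊔n; m≤n⊔m; module ≤-Reasoning)
open import Data.Product using (Σ; ∃-syntax; _×_; _,_)
open import Data.Sum using (_⊎_; inj₁; inj₂; [_,_]; swap)
open import Data.Fin using (Fin; zero; suc; fromℕ; inject₁; _≟_)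
open import Data.Fin.Subset using (Subset; _∈_; _∉_; ⊥; ⁅_⁆; ∣_∣; inside; outside)
open import Data.Fin.Subset.Properties using (p⊆q⇒∣p∣≤∣q∣; ∉⊥; x∈⁅x⁆)
open import Data.Vec using (_∷_; []; lookup; _[_]≔_; here; there)
open import Data.Vec.Properties using (lookup⇒[]=; []=⇒lookup; lookup∘update′)
open import Data.Bool using (true; false; not)
open import Data.List using (List; []; _∷_; length; map; foldr; allFin)
open import Data.List.Relation.Unary.Any using (here; there)
import Data.List.Membership.Propositional as List
open import Data.List.Membership.Propositional.Properties using (∈-allFin)
open import Function using (_∘_)
open import Function.Bundles using (mk⇔)
open import Relation.Binary.PropositionalEquality using (_≡_; _≢_; refl; sym; trans; cong; subst)
open import Relation.Nullary using (yes; no; contradiction)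

private
  variable
    n : ℕ

rank-increasing⇒acyclic : {E : Digraph n} (rank : Fin n → ℕ) →
                          (∀ {u v} → E u v → rank u < rank v) → Acyclic E
rank-increasing⇒acyclic {E = E} rank increasing v walk = <-irrefl refl (along walk)
  where
  along : ∀ {u w} → Walk⁺ E u w → rank u < rank w
  along (edge e)   = increasing e
  along (e ∷ʷ es)  = <-trans (increasing e) (along es)

successors⇒uniqueSink : {E : Digraph n} {r : Fin n} → IsSink E r →
                        (∀ v → v ≢ r → ∃[ w ] E v w) → UniqueSink E r
successors⇒uniqueSink {E = E} {r = r} r-sink successor = r-sink , only-r
  where
  only-r : ∀ v → IsSink E v → v ≡ r
  only-r v v-sink with v ≟ r
  ... | yes v≡r = v≡r
  ... | no  v≢r with successor v v≢r
  ...   | w , e = contradiction e (v-sink w)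

orientations⇒sameUnderlying : {E₁ E₂ : Digraph n} →
                              (∀ {u v} → E₁ u v → E₂ u v ⊎ E₂ v u) →
                              (∀ {u v} → E₂ u v → E₁ u v ⊎ E₁ v u) →
                              SameUnderlying E₁ E₂
orientations⇒sameUnderlying to from u v =
  mk⇔ [ to , swap ∘ to ] [ from , swap ∘ from ]

x∉p⇒lookup≡outside : ∀ {x} (p : Subset n) → x ∉ p → lookup p x ≡ outside
x∉p⇒lookup≡outside {x = x} p x∉p with lookup p x in eq
... | true  = contradiction (lookup⇒[]= x p eq) x∉p
... | false = refl

x∉p⇒x∉p[y]≔b : ∀ {x y} (p : Subset n) b → y ≢ x → x ∉ p → x ∉ p [ y ]≔ b
x∉p⇒x∉p[y]≔b {x = x} p b y≢x x∉p x∈p′ =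
  x∉p (lookup⇒[]= x p (trans (sym (lookup∘update′ (y≢x ∘ sym) p b)) ([]=⇒lookup x∈p′)))

∣p[x]≔inside∣≡1+∣p∣ : ∀ (p : Subset n) x → x ∉ p → ∣ p [ x ]≔ inside ∣ ≡ suc ∣ p ∣
∣p[x]≔inside∣≡1+∣p∣ (outside ∷ p) zero    x∉p = refl
∣p[x]≔inside∣≡1+∣p∣ (inside  ∷ p) zero    x∉p = contradiction here x∉p
∣p[x]≔inside∣≡1+∣p∣ (outside ∷ p) (suc x) x∉p = ∣p[x]≔inside∣≡1+∣p∣ p x (x∉p ∘ there)
∣p[x]≔inside∣≡1+∣p∣ (inside  ∷ p) (suc x) x∉p = cong suc (∣p[x]≔inside∣≡1+∣p∣ p x (x∉p ∘ there))

f≤foldr-⊔ : ∀ {A : Set} (f : A → ℕ) {a : A} (xs : List A) → a List.∈ xs →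
            f a ≤ foldr _⊔_ 0 (map f xs)
f≤foldr-⊔ f (x ∷ xs) (here refl) = m≤m⊔n (f x) _
f≤foldr-⊔ f (x ∷ xs) (there a∈xs) = ≤-trans (f≤foldr-⊔ f xs a∈xs) (m≤n⊔m (f x) _)

∣config∣≤pebbles : {E : Digraph n} {r : Fin n} (p : Pebbling E r) (i : Fin (suc (m p))) →
                   ∣ config p i ∣ ≤ pebbles p
∣config∣≤pebbles p i = f≤foldr-⊔ (λ j → ∣ config p j ∣) (allFin (suc (m p))) (∈-allFin i)

move-onto : {E : Digraph n} {P Q : Subset n} {v : Fin n} → Move E P Q → v ∉ P →
            v ∉ Q ⊎ ((∀ u → E u v → u ∈ P) × Q ≡ P [ v ]≔ inside)
move-onto {P = P} {v = v} (w , pre , refl) v∉P with w ≟ v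
... | yes refl = inj₂ (pre , cong (λ b → P [ v ]≔ not b) (x∉p⇒lookup≡outside P v∉P))
... | no  w≢v  = inj₁ (x∉p⇒x∉p[y]≔b P _ w≢v v∉P)

firstPlacement : {E : Digraph n} {v : Fin n} (m : ℕ) (c : Fin (suc m) → Subset n) →
                 (∀ i → Move E (c (inject₁ i)) (c (suc i))) →
                 v ∉ c zero → v ∈ c (fromℕ m) →
                 ∃[ i ] (∀ u → E u v → u ∈ c (inject₁ i))
                        × v ∉ c (inject₁ i)
                        × c (suc i) ≡ c (inject₁ i) [ v ]≔ inside
firstPlacement zero    c moves v∉c₀ v∈cₘ = contradiction v∈cₘ v∉c₀
firstPlacement (suc m) c moves v∉c₀ v∈cₘ with move-onto (moves zero) v∉c₀
... | inj₂ (pre , c₁≡) = zero , pre , v∉c₀ , c₁≡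
... | inj₁ v∉c₁ with firstPlacement m (c ∘ suc) (moves ∘ suc) v∉c₁ v∈cₘ
...   | i , placed = suc i , placed

inNeighbours<pebbles : {E : Digraph n} {r : Fin n} (p : Pebbling E r) (S : Subset n) →
                       (∀ {u} → u ∈ S → E u r) → suc ∣ S ∣ ≤ pebbles p
inNeighbours<pebbles {r = r} p S S⇒E
  with firstPlacement (m p) (config p) (steps p)
         (subst (r ∉_) (sym (start p)) ∉⊥) (subst (r ∈_) (sym (finish p)) (x∈⁅x⁆ r))
... | i , pre , r∉P , placed = begin
  suc ∣ S ∣                          ≤⟨ s≤s (p⊆q⇒∣p∣≤∣q∣ (λ u∈S → pre _ (S⇒E u∈S))) ⟩
  suc ∣ config p (inject₁ i) ∣       ≡⟨ sym (∣p[x]≔inside∣≡1+∣p∣ _ r r∉P) ⟩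
  ∣ config p (inject₁ i) [ r ]≔ inside ∣ ≡⟨ cong ∣_∣ (sym placed) ⟩
  ∣ config p (suc i) ∣               ≤⟨ ∣config∣≤pebbles p (suc i) ⟩
  pebbles p                          ∎
  where open ≤-Reasoning

toggle : Subset n → Fin n → Subset n
toggle P v = P [ v ]≔ not (lookup P v)

configs : Subset n → (vs : List (Fin n)) → Fin (suc (length vs)) → Subset n
configs P vs       zero    = P
configs P (v ∷ vs) (suc i) = configs (toggle P v) vs i

data LegalToggles {n} (E : Digraph n) : Subset n → List (Fin n) → Set where
  []  : ∀ {P} → LegalToggles E P []
  _∷_ : ∀ {P v vs} → (∀ u → E u v → u ∈ P) → LegalToggles E (toggle P v) vs →
        LegalToggles E P (v ∷ vs)

legal⇒moves : {E : Digraph n} {P : Subset n} {vs : List (Fin n)} → LegalToggles E P vs →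
              ∀ i → Move E (configs P vs (inject₁ i)) (configs P vs (suc i))
legal⇒moves (pre ∷ _)     zero    = _ , pre , refl
legal⇒moves (_ ∷ legal)   (suc i) = legal⇒moves legal i

pebblingByToggles : {E : Digraph n} {r : Fin n} (vs : List (Fin n)) → LegalToggles E ⊥ vs →
                    configs ⊥ vs (fromℕ (length vs)) ≡ ⁅ r ⁆ → Pebbling E r
pebblingByToggles vs legal ends = record
  { m = length vs ; config = configs ⊥ vs ; start = refl ; finish = ends
  ; steps = legal⇒moves legal }

v₀ v₁ v₂ v₃ : Fin 4
v₀ = zero
v₁ = suc zero
v₂ = suc (suc zero)
v₃ = suc (suc (suc zero))

data E₁ : Digraph 4 where
  1→0 : E₁ v₁ v₀
  2→0 : E₁ v₂ v₀
  3→0 : E₁ v₃ v₀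
  2→1 : E₁ v₂ v₁

data E₂ : Digraph 4 where
  0→1 : E₂ v₀ v₁
  0→2 : E₂ v₀ v₂
  3→0 : E₂ v₃ v₀
  2→1 : E₂ v₂ v₁

G₁ : DAG 4
G₁ = record { E = E₁ ; acyclic = rank-increasing⇒acyclic rank increasing ; sink = v₀
            ; unique = successors⇒uniqueSink (λ _ ()) successor }
  where
  rank : Fin 4 → ℕ
  rank zero                   = 3
  rank (suc zero)             = 2
  rank (suc (suc zero))       = 1
  rank (suc (suc (suc zero))) = 0

  increasing : ∀ {u v} → E₁ u v → rank u < rank v
  increasing 1→0 = s≤s (s≤s (s≤s z≤n))
  increasing 2→0 = s≤s (s≤s z≤n)
  increasing 3→0 = s≤s z≤n
  increasing 2→1 = s≤s (s≤s z≤n)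

  successor : ∀ v → v ≢ v₀ → ∃[ w ] E₁ v w
  successor zero                   v≢v₀ = contradiction refl v≢v₀
  successor (suc zero)             _    = v₀ , 1→0
  successor (suc (suc zero))       _    = v₀ , 2→0
  successor (suc (suc (suc zero))) _    = v₀ , 3→0

G₂ : DAG 4
G₂ = record { E = E₂ ; acyclic = rank-increasing⇒acyclic rank increasing ; sink = v₁
            ; unique = successors⇒uniqueSink (λ _ ()) successor }
  where
  rank : Fin 4 → ℕ
  rank zero                   = 1
  rank (suc zero)             = 3
  rank (suc (suc zero))       = 2
  rank (suc (suc (suc zero))) = 0

  increasing : ∀ {u v} → E₂ u v → rank u < rank v
  increasing 0→1 = s≤s (s≤s z≤n)
  increasing 0→2 = s≤s (s≤s z≤n)
  increasing 3→0 = s≤s z≤n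
  increasing 2→1 = s≤s (s≤s (s≤s z≤n))

  successor : ∀ v → v ≢ v₁ → ∃[ w ] E₂ v w
  successor zero                   _    = v₁ , 0→1
  successor (suc zero)             v≢v₁ = contradiction refl v≢v₁
  successor (suc (suc zero))       _    = v₁ , 2→1
  successor (suc (suc (suc zero))) _    = v₀ , 3→0

E₁⇒E₂ : ∀ {u v} → E₁ u v → E₂ u v ⊎ E₂ v u
E₁⇒E₂ 1→0 = inj₂ 0→1
E₁⇒E₂ 2→0 = inj₂ 0→2
E₁⇒E₂ 3→0 = inj₁ 3→0
E₁⇒E₂ 2→1 = inj₁ 2→1

E₂⇒E₁ : ∀ {u v} → E₂ u v → E₁ u v ⊎ E₁ v u
E₂⇒E₁ 0→1 = inj₂ 1→0
E₂⇒E₁ 0→2 = inj₂ 2→0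
E₂⇒E₁ 3→0 = inj₁ 3→0
E₂⇒E₁ 2→1 = inj₁ 2→1

rev[G₁]≡4 : IsRev G₁ 4
rev[G₁]≡4 = (pebbling , refl) , λ p → inNeighbours<pebbles p S S⇒E₁
  where
  pebbling : Pebbling E₁ v₀
  pebbling = pebblingByToggles (v₂ ∷ v₁ ∷ v₃ ∷ v₀ ∷ v₃ ∷ v₁ ∷ v₂ ∷ [])
    ( (λ _ ())
    ∷ (λ { _ 2→1 → lookup⇒[]= _ _ refl })
    ∷ (λ _ ())
    ∷ (λ { _ 1→0 → lookup⇒[]= _ _ refl ; _ 2→0 → lookup⇒[]= _ _ refl
         ; _ 3→0 → lookup⇒[]= _ _ refl })
    ∷ (λ _ ())
    ∷ (λ { _ 2→1 → lookup⇒[]= _ _ refl })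
    ∷ (λ _ ())
    ∷ [])
    refl

  S : Subset 4
  S = outside ∷ inside ∷ inside ∷ inside ∷ []

  S⇒E₁ : ∀ {u} → u ∈ S → E₁ u v₀
  S⇒E₁ (there here)                 = 1→0
  S⇒E₁ (there (there here))         = 2→0
  S⇒E₁ (there (there (there here))) = 3→0

rev[G₂]≡3 : IsRev G₂ 3
rev[G₂]≡3 = (pebbling , refl) , λ p → inNeighbours<pebbles p S S⇒E₂
  where
  pebbling : Pebbling E₂ v₁
  pebbling = pebblingByToggles (v₃ ∷ v₀ ∷ v₃ ∷ v₂ ∷ v₁ ∷ v₂ ∷ v₃ ∷ v₀ ∷ v₃ ∷ [])
    ( (λ _ ())
    ∷ (λ { _ 3→0 → lookup⇒[]= _ _ refl })
    ∷ (λ _ ())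
    ∷ (λ { _ 0→2 → lookup⇒[]= _ _ refl })
    ∷ (λ { _ 0→1 → lookup⇒[]= _ _ refl ; _ 2→1 → lookup⇒[]= _ _ refl })
    ∷ (λ { _ 0→2 → lookup⇒[]= _ _ refl })
    ∷ (λ _ ())
    ∷ (λ { _ 3→0 → lookup⇒[]= _ _ refl })
    ∷ (λ _ ())
    ∷ [])
    refl

  S : Subset 4
  S = inside ∷ outside ∷ inside ∷ outside ∷ []

  S⇒E₂ : ∀ {u} → u ∈ S → E₂ u v₁
  S⇒E₂ here                 = 0→1
  S⇒E₂ (there (there here)) = 2→1
  S⇒E₂ (there (there (there (there ()))))

mainTheorem6 : Σ ℕ λ n → Σ (DAG n) λ G₁ → Σ (DAG n) λ G₂ →
    SameUnderlying (E G₁) (E G₂) ×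
    Σ ℕ λ k₁ → Σ ℕ λ k₂ → IsRev G₁ k₁ × IsRev G₂ k₂ × k₁ ≢ k₂
mainTheorem6 =
  4 , G₁ , G₂ , orientations⇒sameUnderlying E₁⇒E₂ E₂⇒E₁ ,
  4 , 3 , rev[G₁]≡4 , rev[G₂]≡3 , λ ()
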